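{- A regular language $L\subseteq\Sigma^*$ is weakly acyclic if and only if for all $u\in\Sigma^*$ and $v\in\Sigma^+$, $L^u=L^{uv}$ implies $L^u=L^{uw}$ for every $w\in\mathrm{alp}(v)^*$.
   Context: For a word $w$, $\mathrm{alp}(w)$ is the set of letters occurring in $w$. The residual of $L$ with respect to $u$ is $L^u:=\{v\in\Sigma^*: uv\in L\}$. A DFA $(Q,\Sigma,\delta,q_0,F)$ is weakly acyclic if for every $q\in Q$, $w\in\Sigma^+$ and $a\in\mathrm{alp}(w)$, $\delta(q,w)=q$ implies $\delta(q,a)=q$. A language is weakly acyclic if it is accepted by some weakly acyclic DFA. -}

module Defs where

open import Data.Nat using (ℕ)
open import Data.Fin using (Fin)
open import Data.Bool using (Bool; true)
open import Data.List using (List; []; _∷_; _++_)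
open import Data.List.Relation.Unary.All using (All)
open import Data.List.Membership.Propositional using (_∈_)
open import Data.Product using (Σ; ∃; _×_)
open import Function.Bundles using (_⇔_)
open import Relation.Binary.PropositionalEquality using (_≡_)
open import Relation.Nullary using (¬_)

Language : Set → Set₁
Language Σ = List Σ → Set

_≐_ : {Σ : Set} → Language Σ → Language Σ → Set
L ≐ K = ∀ x → L x ⇔ K x

residual : {Σ : Set} → Language Σ → List Σ → Language Σ
residual L u v = L (u ++ v)

NonEmpty : {Σ : Set} → List Σ → Set
NonEmpty w = ¬ (w ≡ [])

InAlpStar : {Σ : Set} → List Σ → List Σ → Set
InAlpStar v w = All (_∈ v) w

record DFA (Σ : Set) : Set where
  field
    n  : ℕ
    δ  : Fin n → Σ → Fin n
    q₀ : Fin n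
    F  : Fin n → Bool

module _ {Σ : Set} (A : DFA Σ) where
  open DFA A

  δ* : Fin n → List Σ → Fin n
  δ* q []       = q
  δ* q (a ∷ w) = δ* (δ q a) w

  Accepts : List Σ → Set
  Accepts w = F (δ* q₀ w) ≡ true

  WeaklyAcyclicDFA : Set
  WeaklyAcyclicDFA = ∀ (q : Fin n) (w : List Σ) (a : Σ) →
    NonEmpty w → a ∈ w → δ* q w ≡ q → δ q a ≡ q

AcceptedBy : {Σ : Set} → Language Σ → DFA Σ → Set
AcceptedBy L A = L ≐ Accepts A

Regular : {Σ : Set} → Language Σ → Set
Regular {Σ} L = Σ[ A ∈ DFA Σ ] AcceptedBy L A
  where open import Data.Product using (Σ-syntax)

WeaklyAcyclic : {Σ : Set} → Language Σ → Set
WeaklyAcyclic {Σ} L = Σ[ A ∈ DFA Σ ] (WeaklyAcyclicDFA A × AcceptedBy L A)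
  where open import Data.Product using (Σ-syntax)

-- In a weakly acyclic automaton the only cycles are self-loops.
-- (⇒) If v loops on the residual of u, pigeonhole on the states reached by u vⁱ gives a state
-- r on which some power v^(d+1) is a cycle; weak acyclicity makes every letter of v a
-- self-loop at r, so u vⁱ w also reaches r, and L^u = L^(u vⁱ) = L^(u vⁱ w) = L^(u w).
-- (⇐) In any DFA for L, turn every transition q –a→ lying on a cycle through q into a
-- self-loop. A cycle of the new automaton traces a cycle of the old one using the same
-- letters, so the new automaton is weakly acyclic. At a reachable state q = δ(q₀,u) with a
-- cycle v through a we have L^u = L^(u v), so the hypothesis gives L^u = L^(u a): the
-- redirected transition only moves to an equivalent state and the language is unchanged.
-- Lying on a cycle is decidable since reachability is: a path longer than the number of
-- states contains a loop that can be cut out.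

module Submission where

open import Defs
open import Data.Bool using (true)
open import Data.Fin using (Fin; toℕ; _≟_)
open import Data.Fin.Properties using (pigeonhole; any?; toℕ<n)
open import Data.List using (List; []; _∷_; _++_; [_]; length; take; drop)
open import Data.List.Properties using (++-assoc; length-++; length-take; length-drop; take++drop≡id)
open import Data.List.Membership.Propositional using (_∈_)
open import Data.List.Membership.Propositional.Properties using (∈-++⁺ˡ; ∈-++⁺ʳ)
open import Data.List.Relation.Unary.All as All using ([]; _∷_)
open import Data.List.Relation.Unary.Any using (here; there)
open import Data.Nat using (ℕ; zero; suc; _+_; _∸_; _⊓_; _≤_; _<_; s≤s; _≤?_)
open import Data.Nat.Induction using (<-wellFounded)
open import Data.Nat.Properties using (n<1+n; m⊓n≤m; +-monoˡ-≤; +-monoˡ-<; m+[n∸m]≡n; +-suc; <⇒≤; ≰⇒>; module ≤-Reasoning)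
open import Data.Product using (∃; ∃₂; _×_; _,_)
open import Data.Sum using (_⊎_; inj₁; inj₂)
open import Function.Bundles using (_⇔_; mk⇔; Equivalence)
open import Function.Properties.Equivalence using (⇔-isEquivalence)
open import Induction.WellFounded using (Acc; acc)
open import Level using (0ℓ) renaming (suc to lsuc)
open import Relation.Binary.Bundles using (Setoid)
open import Relation.Binary.Structures using (IsEquivalence)
open import Relation.Binary.PropositionalEquality using (_≡_; refl; sym; trans; cong; cong₂; subst; module ≡-Reasoning)
open import Relation.Nullary using (Dec; yes; no; contradiction)
open import Relation.Nullary.Decidable using (map′; _×-dec_; _⊎-dec_)
import Relation.Binary.Reasoning.Setoid as SetoidReasoning

open Equivalence using (to; from)

module ⇔ {ℓ} = IsEquivalence (⇔-isEquivalence {ℓ})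

≐-setoid : Set → Setoid (lsuc 0ℓ) 0ℓ
≐-setoid Σ = record
  { Carrier       = Language Σ
  ; _≈_           = _≐_
  ; isEquivalence = record
    { refl  = λ _ → ⇔.refl
    ; sym   = λ L≐K x → ⇔.sym (L≐K x)
    ; trans = λ L≐K K≐M x → ⇔.trans (L≐K x) (K≐M x)
    }
  }

module ≐ {Σ : Set} = Setoid (≐-setoid Σ)
module ≐-Reasoning {Σ : Set} = SetoidReasoning (≐-setoid Σ)

residual-cong : ∀ {Σ : Set} {L K : Language Σ} → L ≐ K → ∀ u → residual L u ≐ residual K u
residual-cong L≐K u v = L≐K (u ++ v)

length-take++drop< : ∀ {X : Set} {i j} (w : List X) → i < j → j ≤ length w →
                     length (take i w ++ drop j w) < length w
length-take++drop< {i = i} {j} w i<j j≤∣w∣ = begin-strict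
  length (take i w ++ drop j w)          ≡⟨ length-++ (take i w) ⟩
  length (take i w) + length (drop j w)  ≡⟨ cong₂ _+_ (length-take i w) (length-drop j w) ⟩
  i ⊓ length w + (length w ∸ j)          ≤⟨ +-monoˡ-≤ (length w ∸ j) (m⊓n≤m i (length w)) ⟩
  i + (length w ∸ j)                     <⟨ +-monoˡ-< (length w ∸ j) i<j ⟩
  j + (length w ∸ j)                     ≡⟨ m+[n∸m]≡n j≤∣w∣ ⟩
  length w                               ∎
  where open ≤-Reasoning

_^_ : ∀ {X : Set} → List X → ℕ → List X
v ^ zero  = []
v ^ suc m = v ++ v ^ m

^-+ : ∀ {X : Set} (v : List X) i j → v ^ (i + j) ≡ v ^ i ++ v ^ j
^-+ v zero    j = refl
^-+ v (suc i) j = trans (cong (v ++_) (^-+ v i j)) (sym (++-assoc v (v ^ i) (v ^ j)))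

∈⇒NonEmpty : ∀ {X : Set} {x : X} {w} → x ∈ w → NonEmpty w
∈⇒NonEmpty () refl

LoopsAlphabetClosed : {Σ : Set} → Language Σ → Set
LoopsAlphabetClosed {Σ} L = ∀ (u v : List Σ) → NonEmpty v → residual L u ≐ residual L (u ++ v) →
  ∀ (w : List Σ) → InAlpStar v w → residual L u ≐ residual L (u ++ w)

module _ {Σ : Set} (A : DFA Σ) where
  open DFA A

  δ*-++ : ∀ q x y → δ* A q (x ++ y) ≡ δ* A (δ* A q x) y
  δ*-++ q []      y = refl
  δ*-++ q (a ∷ x) y = δ*-++ (δ q a) x y

  Lang : Fin n → Language Σ
  Lang q w = F (δ* A q w) ≡ true

  Lang-δ* : ∀ q x → Lang (δ* A q x) ≐ residual (Lang q) x
  Lang-δ* q x y = ⇔.reflexive (cong (λ s → F s ≡ true) (sym (δ*-++ q x y)))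

  Lang-δ*-cong : ∀ {p p′} → Lang p ≐ Lang p′ → ∀ x → Lang (δ* A p x) ≐ Lang (δ* A p′ x)
  Lang-δ*-cong {p} {p′} p≐p′ x =
    ≐.trans (Lang-δ* p x) (≐.trans (residual-cong p≐p′ x) (≐.sym (Lang-δ* p′ x)))

  Reachable : Fin n → Fin n → Set
  Reachable q r = ∃ λ w → δ* A q w ≡ r

  Reachable-trans : ∀ {p q r} → Reachable p q → Reachable q r → Reachable p r
  Reachable-trans {p} (x , refl) (y , refl) = x ++ y , δ*-++ p x y

  δ*-take++drop : ∀ q w i j → δ* A q (take i w) ≡ δ* A q (take j w) →
                  δ* A q (take i w ++ drop j w) ≡ δ* A q w
  δ*-take++drop q w i j same = begin
    δ* A q (take i w ++ drop j w)        ≡⟨ δ*-++ q (take i w) (drop j w) ⟩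
    δ* A (δ* A q (take i w)) (drop j w)  ≡⟨ cong (λ s → δ* A s (drop j w)) same ⟩
    δ* A (δ* A q (take j w)) (drop j w)  ≡⟨ δ*-++ q (take j w) (drop j w) ⟨
    δ* A q (take j w ++ drop j w)        ≡⟨ cong (δ* A q) (take++drop≡id j w) ⟩
    δ* A q w                             ∎
    where open ≡-Reasoning

  cut-loop : ∀ q w → n < length w → ∃ λ w′ → length w′ < length w × δ* A q w′ ≡ δ* A q w
  cut-loop q w n<∣w∣ =
    let i , j , i<j , same = pigeonhole n<∣w∣ (λ i → δ* A q (take (toℕ i) w))
    in take (toℕ i) w ++ drop (toℕ j) w ,
       length-take++drop< w i<j (<⇒≤ (toℕ<n j)) ,
       δ*-take++drop q w (toℕ i) (toℕ j) same

  shorten : ∀ q w → ∃ λ w′ → length w′ ≤ n × δ* A q w′ ≡ δ* A q w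
  shorten q w = go w (<-wellFounded (length w))
    where
    go : ∀ w → Acc _<_ (length w) → ∃ λ w′ → length w′ ≤ n × δ* A q w′ ≡ δ* A q w
    go w (acc rs) with length w ≤? n
    ... | yes ∣w∣≤n = w , ∣w∣≤n , refl
    ... | no  ∣w∣≰n =
      let w′ , shorter , same  = cut-loop q w (≰⇒> ∣w∣≰n)
          w″ , ∣w″∣≤n , same′  = go w′ (rs shorter)
      in w″ , ∣w″∣≤n , trans same′ same

  ReachableWithin : ℕ → Fin n → Fin n → Set
  ReachableWithin zero    q r = q ≡ r
  ReachableWithin (suc m) q r = q ≡ r ⊎ ∃ λ a → ReachableWithin m (δ q a) r

  within⇒reachable : ∀ m {q r} → ReachableWithin m q r → Reachable q r
  within⇒reachable zero    q≡r                = [] , q≡r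
  within⇒reachable (suc m) (inj₁ q≡r)         = [] , q≡r
  within⇒reachable (suc m) (inj₂ (a , δqa⇝r)) =
    let w , δqaw≡r = within⇒reachable m δqa⇝r in a ∷ w , δqaw≡r

  reachableWithin : ∀ m q w → length w ≤ m → ReachableWithin m q (δ* A q w)
  reachableWithin zero    q []      _           = refl
  reachableWithin (suc m) q []      _           = inj₁ refl
  reachableWithin (suc m) q (a ∷ w) (s≤s ∣w∣≤m) = inj₂ (a , reachableWithin m (δ q a) w ∣w∣≤m)

  reachable⇒within : ∀ {q r} → Reachable q r → ReachableWithin n q r
  reachable⇒within {q} (w , refl) =
    let w′ , ∣w′∣≤n , same = shorten q w
    in subst (ReachableWithin n q) same (reachableWithin n q w′ ∣w′∣≤n)

  δ*-^-loop : ∀ q v {i j} → i < j → δ* A q (v ^ i) ≡ δ* A q (v ^ j) →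
              δ* A (δ* A q (v ^ i)) (v ^ suc (j ∸ suc i)) ≡ δ* A q (v ^ i)
  δ*-^-loop q v {i} {j} i<j same = begin
    δ* A (δ* A q (v ^ i)) (v ^ suc d)  ≡⟨ δ*-++ q (v ^ i) (v ^ suc d) ⟨
    δ* A q (v ^ i ++ v ^ suc d)        ≡⟨ cong (δ* A q) (^-+ v i (suc d)) ⟨
    δ* A q (v ^ (i + suc d))           ≡⟨ cong (λ m → δ* A q (v ^ m)) (trans (+-suc i d) (m+[n∸m]≡n i<j)) ⟩
    δ* A q (v ^ j)                     ≡⟨ same ⟨
    δ* A q (v ^ i)                     ∎
    where
    d = j ∸ suc i
    open ≡-Reasoning

  δ*-^-cycle : ∀ q v → ∃₂ λ i d → δ* A (δ* A q (v ^ i)) (v ^ suc d) ≡ δ* A q (v ^ i)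
  δ*-^-cycle q v =
    let i , j , i<j , same = pigeonhole (n<1+n n) (λ i → δ* A q (v ^ toℕ i))
    in toℕ i , toℕ j ∸ suc (toℕ i) , δ*-^-loop q v i<j same

  Lang-^ : ∀ {p v} → Lang p ≐ Lang (δ* A p v) → ∀ m → Lang p ≐ Lang (δ* A p (v ^ m))
  Lang-^ p≐pv zero = ≐.refl
  Lang-^ {p} {v} p≐pv (suc m) = begin
    Lang p                          ≈⟨ Lang-^ p≐pv m ⟩
    Lang (δ* A p (v ^ m))           ≈⟨ Lang-δ*-cong p≐pv (v ^ m) ⟩
    Lang (δ* A (δ* A p v) (v ^ m))  ≡⟨ cong Lang (δ*-++ p v (v ^ m)) ⟨
    Lang (δ* A p (v ^ suc m))       ∎
    where open ≐-Reasoning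

  weaklyAcyclic-loop : WeaklyAcyclicDFA A → ∀ {q v w} → δ* A q v ≡ q → InAlpStar v w → δ* A q w ≡ q
  weaklyAcyclic-loop wa         loop []         = refl
  weaklyAcyclic-loop wa {q} {v} loop (b∈v ∷ bs)
    rewrite wa q v _ (∈⇒NonEmpty b∈v) b∈v loop = weaklyAcyclic-loop wa loop bs

  LoopsAlphabetClosedAt : Fin n → Set
  LoopsAlphabetClosedAt p = ∀ v → NonEmpty v → Lang p ≐ Lang (δ* A p v) →
    ∀ w → InAlpStar v w → Lang p ≐ Lang (δ* A p w)

  weaklyAcyclic-loopsAlphabetClosedAt : WeaklyAcyclicDFA A → ∀ p → LoopsAlphabetClosedAt p
  weaklyAcyclic-loopsAlphabetClosedAt wa p v _ p≐pv w w∈alp⋆v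
    with i , d , loop ← δ*-^-cycle p v = begin
      Lang p                          ≈⟨ Lang-^ p≐pv i ⟩
      Lang (δ* A p (v ^ i))           ≡⟨ cong Lang (weaklyAcyclic-loop wa loop (All.map ∈-++⁺ˡ w∈alp⋆v)) ⟨
      Lang (δ* A (δ* A p (v ^ i)) w)  ≈⟨ Lang-δ*-cong (Lang-^ p≐pv i) w ⟨
      Lang (δ* A p w)                 ∎
    where open ≐-Reasoning

  module _ {L : Language Σ} (accepts : AcceptedBy L A) where

    residual-accepted : ∀ u → residual L u ≐ Lang (δ* A q₀ u)
    residual-accepted u = ≐.trans (residual-cong accepts u) (≐.sym (Lang-δ* q₀ u))

    residual-++-accepted : ∀ u v → residual L (u ++ v) ≐ Lang (δ* A (δ* A q₀ u) v)
    residual-++-accepted u v =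
      ≐.trans (residual-accepted (u ++ v)) (≐.reflexive (cong Lang (δ*-++ q₀ u v)))

    residual-loop⇔ : ∀ u v →
      (residual L u ≐ residual L (u ++ v)) ⇔ (Lang (δ* A q₀ u) ≐ Lang (δ* A (δ* A q₀ u) v))
    residual-loop⇔ u v = mk⇔
      (λ e → ≐.trans (≐.sym (residual-accepted u)) (≐.trans e (residual-++-accepted u v)))
      (λ e → ≐.trans (residual-accepted u) (≐.trans e (≐.sym (residual-++-accepted u v))))

    loopsAlphabetClosed⇔ : LoopsAlphabetClosed L ⇔ (∀ q → Reachable q₀ q → LoopsAlphabetClosedAt q)
    loopsAlphabetClosed⇔ = mk⇔
      (λ { closed _ (u , refl) v v≢[] e w w∈alp⋆v →
             to (residual-loop⇔ u w) (closed u v v≢[] (from (residual-loop⇔ u v) e) w w∈alp⋆v) })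
      (λ closed u v v≢[] e w w∈alp⋆v →
             from (residual-loop⇔ u w) (closed _ (u , refl) v v≢[] (to (residual-loop⇔ u v) e) w w∈alp⋆v))

module _ {Σ : Set} (A : DFA Σ) (δ′ : Fin (DFA.n A) → Σ → Fin (DFA.n A)) where
  open DFA A

  Lang-withTransitions : (P : Fin n → Set) →
    (∀ {q} a → P q → P (δ′ q a)) → (∀ {q} a → P q → Lang A (δ′ q a) ≐ Lang A (δ q a)) →
    ∀ {q} → P q → Lang (record A { δ = δ′ }) q ≐ Lang A q
  Lang-withTransitions P closed equivalent q∈P []      = ⇔.refl
  Lang-withTransitions P closed equivalent q∈P (a ∷ w) =
    ⇔.trans (Lang-withTransitions P closed equivalent (closed a q∈P) w) (equivalent a q∈P w)

module _ {k : ℕ} (A : DFA (Fin k)) where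
  open DFA A

  reachableWithin? : ∀ m q r → Dec (ReachableWithin A m q r)
  reachableWithin? zero    q r = q ≟ r
  reachableWithin? (suc m) q r = q ≟ r ⊎-dec any? (λ a → reachableWithin? m (δ q a) r)

  reachable? : ∀ q r → Dec (Reachable A q r)
  reachable? q r = map′ (within⇒reachable A n) (reachable⇒within A) (reachableWithin? n q r)

  Passes : Fin n → Fin k → Fin n → Set
  Passes q a r = ∃ λ s → Reachable A q s × Reachable A (δ s a) r

  OnCycle : Fin n → Fin k → Set
  OnCycle q a = Passes q a q

  onCycle? : ∀ q a → Dec (OnCycle q a)
  onCycle? q a = any? (λ s → reachable? q s ×-dec reachable? (δ s a) q)

  collapsedδ : Fin n → Fin k → Fin n
  collapsedδ q a with onCycle? q a
  ... | yes _ = q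
  ... | no  _ = δ q a

  collapse : DFA (Fin k)
  collapse = record A { δ = collapsedδ }

  collapsedδ-onCycle : ∀ {q a} → OnCycle q a → collapsedδ q a ≡ q
  collapsedδ-onCycle {q} {a} cycle with onCycle? q a
  ... | yes _      = refl
  ... | no  ¬cycle = contradiction cycle ¬cycle

  collapse-reachable : ∀ q w → Reachable A q (δ* collapse q w)
  collapse-reachable q []      = [] , refl
  collapse-reachable q (b ∷ w) with onCycle? q b
  ... | yes _ = collapse-reachable q w
  ... | no  _ = Reachable-trans A ([ b ] , refl) (collapse-reachable (δ q b) w)

  collapse-passes : ∀ q w {a} → a ∈ w → Passes q a (δ* collapse q w)
  collapse-passes q (b ∷ w) (here refl) with onCycle? q b
  ... | yes (s , q⇝s , δsb⇝q) = s , q⇝s , Reachable-trans A δsb⇝q (collapse-reachable q w)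
  ... | no  _                 = q , ([] , refl) , collapse-reachable (δ q b) w
  collapse-passes q (b ∷ w) (there a∈w) with onCycle? q b
  ... | yes _ = collapse-passes q w a∈w
  ... | no  _ =
    let s , δqb⇝s , δsa⇝r = collapse-passes (δ q b) w a∈w
    in s , Reachable-trans A ([ b ] , refl) δqb⇝s , δsa⇝r

  collapse-weaklyAcyclic : WeaklyAcyclicDFA collapse
  collapse-weaklyAcyclic q w a _ a∈w loop =
    collapsedδ-onCycle (subst (Passes q a) loop (collapse-passes q w a∈w))

  collapsedδ-reachable : ∀ {p q} a → Reachable A p q → Reachable A p (collapsedδ q a)
  collapsedδ-reachable {q = q} a p⇝q with onCycle? q a
  ... | yes _ = p⇝q
  ... | no  _ = Reachable-trans A p⇝q ([ a ] , refl)

  onCycle-Lang : ∀ {q a} → LoopsAlphabetClosedAt A q → OnCycle q a → Lang A q ≐ Lang A (δ q a)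
  onCycle-Lang {q} {a} closed (s , (x , refl) , (y , δsay≡q)) =
    closed v (∈⇒NonEmpty a∈v) (≐.reflexive (cong (Lang A) (sym cycle))) [ a ] (a∈v ∷ [])
    where
    v = x ++ a ∷ y
    a∈v : a ∈ v
    a∈v = ∈-++⁺ʳ x (here refl)
    cycle : δ* A q v ≡ q
    cycle = trans (δ*-++ A q x (a ∷ y)) δsay≡q

  module _ (closed : ∀ q → Reachable A q₀ q → LoopsAlphabetClosedAt A q) where

    collapsedδ-Lang : ∀ {q} a → Reachable A q₀ q → Lang A (collapsedδ q a) ≐ Lang A (δ q a)
    collapsedδ-Lang {q} a q₀⇝q with onCycle? q a
    ... | yes cycle = onCycle-Lang (closed q q₀⇝q) cycle
    ... | no  _     = ≐.refl

    collapse-accepts : Accepts collapse ≐ Accepts A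
    collapse-accepts =
      Lang-withTransitions A collapsedδ (Reachable A q₀) collapsedδ-reachable collapsedδ-Lang ([] , refl)

weaklyAcyclic⇒loopsAlphabetClosed : ∀ {Σ : Set} {L : Language Σ} → WeaklyAcyclic L → LoopsAlphabetClosed L
weaklyAcyclic⇒loopsAlphabetClosed (B , wa , accepts) =
  from (loopsAlphabetClosed⇔ B accepts) (λ q _ → weaklyAcyclic-loopsAlphabetClosedAt B wa q)

loopsAlphabetClosed⇒weaklyAcyclic : ∀ {k} {L : Language (Fin k)} → Regular L → LoopsAlphabetClosed L → WeaklyAcyclic L
loopsAlphabetClosed⇒weaklyAcyclic (A , accepts) closed =
  collapse A , collapse-weaklyAcyclic A ,
  ≐.trans accepts (≐.sym (collapse-accepts A (to (loopsAlphabetClosed⇔ A accepts) closed)))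

lemma1 : (k : ℕ) (L : Language (Fin k)) → Regular L →
    (WeaklyAcyclic L → ∀ (u v : List (Fin k)) → NonEmpty v → residual L u ≐ residual L (u ++ v) → ∀ (w : List (Fin k)) → InAlpStar v w → residual L u ≐ residual L (u ++ w))
    × ((∀ (u v : List (Fin k)) → NonEmpty v → residual L u ≐ residual L (u ++ v) → ∀ (w : List (Fin k)) → InAlpStar v w → residual L u ≐ residual L (u ++ w)) → WeaklyAcyclic L)
lemma1 k L regular = weaklyAcyclic⇒loopsAlphabetClosed , loopsAlphabetClosed⇒weaklyAcyclic regular
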